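{- Let $k\ge 2$, $t=k+2$, and let $n$ be a positive multiple of $k$. Let $\mathcal T$ be a $k$-color valid triangulation of points $p_1,\ldots,p_{n+2}$ in convex position. Then $\mathcal T$ contains a $t$-ear with ear-edge $p_rp_s$ for some $r\ge 1$ and $s=r+t-1\le n+2$.
   Context: A triangulation of points in convex position is a maximal plane straight-line graph on them. $\mathcal T$ contains a $t$-ear with ear-edge $p_rp_s$ ($s=r+t-1$) if $p_rp_s$ is an edge of $\mathcal T$, so that $\mathcal T$ restricted to $p_r,\ldots,p_s$ is a triangulated $t$-gon that can be split off along $p_rp_s$. Outdegree sequence of a triangulation $\mathcal T$ of $p_1,\ldots,p_{N+2}$: for $1\le i\le N$, $d_i$ is the number of edges $p_ip_j$ of $\mathcal T$ with $j>i$ that are not convex hull edges, except that the hull edge $p_1p_{N+2}$ is counted (for $p_1$). From $(d_1,\ldots,d_N)$ form the $0/1$-sequence $(b_1,\ldots,b_{2N})$ by writing, for $i=1,\ldots,N$ in order, $d_i$ ones followed by one zero. On points $v_1,\ldots,v_{2N}$ in convex position (clockwise) build a matching by scanning $j=1,\ldots,2N$ with a stack: if $b_j=1$ push $j$; if $b_j=0$ pop the top index $\ell$ and add edge $v_\ell v_j$. This yields a plane perfect matching $M(\mathcal T)$. Coloring: for $N$ a multiple of $k$, the vertices are split into blocks $\{v_{(i-1)k+1},\ldots,v_{ik}\}$ and $v_{(i-1)k+r}$ ($1\le r\le k$) gets color $c_r$ if $i$ is odd and $c_{k+1-r}$ if $i$ is even. A triangulation $\mathcal T$ is $k$-color valid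 if every edge of $M(\mathcal T)$ joins two vertices of the same color. -}

module Defs where

open import Data.Nat using (ℕ; zero; suc; _+_; _∸_; _≤_; _<_; _≡ᵇ_)
open import Data.Nat.DivMod using (_/_; _%_)
open import Data.Bool using (Bool; true; false; if_then_else_; _∧_; _∨_; not)
open import Data.List using (List; []; _∷_; _++_; replicate; concatMap; applyUpTo; map)
open import Data.List.Relation.Unary.All using (All)
open import Data.Product using (_×_; _,_; ∃₂)
open import Data.Sum using (_⊎_)
open import Relation.Binary.PropositionalEquality using (_≡_)
open import Relation.Nullary using (¬_)

-- Points p_1, …, p_{n+2} in convex position are identified with their indices
-- 1, …, n+2 (in convex/cyclic order).  An edge set is a Boolean function
-- E i j on pairs with i < j ; E i j ≡ true means the segment p_i p_j is an edge.

Edges : Set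
Edges = ℕ → ℕ → Bool

-- two chords p_i p_j and p_a p_b (i<j, a<b) of a convex polygon cross iff
-- their endpoints strictly interleave
Cross : ℕ → ℕ → ℕ → ℕ → Set
Cross i j a b = (i < a × a < j × j < b) ⊎ (a < i × i < b × b < j)

record Triangulation (n : ℕ) (E : Edges) : Set where
  field
    inRange    : ∀ i j → E i j ≡ true → 1 ≤ i × i < j × j ≤ n + 2
    plane      : ∀ i j a b → E i j ≡ true → E a b ≡ true → ¬ Cross i j a b
    maximal    : ∀ i j → 1 ≤ i → i < j → j ≤ n + 2 → E i j ≡ false →
                 ∃₂ λ a b → E a b ≡ true × Cross i j a b

isHull : ℕ → ℕ → ℕ → Bool
isHull n i j = (j ≡ᵇ suc i) ∨ ((i ≡ᵇ 1) ∧ (j ≡ᵇ n + 2))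

countFrom : (ℕ → Bool) → ℕ → ℕ → ℕ
countFrom f lo zero = 0
countFrom f lo (suc m) = (if f lo then 1 else 0) + countFrom f (suc lo) m

outdeg : ℕ → Edges → ℕ → ℕ
outdeg n E i =
  countFrom (λ j → E i j ∧ (not (isHull n i j) ∨ ((i ≡ᵇ 1) ∧ (j ≡ᵇ n + 2))))
            (suc i) ((n + 2) ∸ i)

outdegSeq : ℕ → Edges → List ℕ
outdegSeq n E = map (outdeg n E) (applyUpTo suc n)

bSeq : ℕ → Edges → List Bool
bSeq n E = concatMap (λ d → replicate d true ++ (false ∷ [])) (outdegSeq n E)

-- stack scan: position j, current stack, remaining sequence;
-- returns matching edges (ℓ , j) meaning v_ℓ v_j.
-- (popping an empty stack never happens for sequences coming from
--  triangulations; it is skipped here.)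
scan : ℕ → List ℕ → List Bool → List (ℕ × ℕ)
scan j st [] = []
scan j st (true ∷ bs) = scan (suc j) (j ∷ st) bs
scan j [] (false ∷ bs) = scan (suc j) [] bs
scan j (ℓ ∷ st) (false ∷ bs) = (ℓ , j) ∷ scan (suc j) st bs

matching : ℕ → Edges → List (ℕ × ℕ)
matching n E = scan 1 [] (bSeq n E)

isEven : ℕ → Bool
isEven m = (m % 2) ≡ᵇ 0

-- colour of v_m (m ≥ 1); colours c_1 … c_k are represented by 1 … k.
-- v_{(i-1)k+r} gets c_r if block i is odd, c_{k+1-r} if i is even.
colour : ℕ → ℕ → ℕ
colour zero m = zero
colour k@(suc _) m =
  if isEven ((m ∸ 1) / k) then suc ((m ∸ 1) % k) else k ∸ ((m ∸ 1) % k)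

ColorValid : ℕ → ℕ → Edges → Set
ColorValid k n E = All (λ e → colour k (Data.Product.proj₁ e) ≡ colour k (Data.Product.proj₂ e)) (matching n E)

-- T contains a t-ear with ear-edge p_r p_s, s = r + t - 1:
-- p_r p_s is an edge of T (the part of T on p_r … p_s is then automatically
-- a triangulated t-gon that splits off along p_r p_s, by planarity/maximality)
HasEarAt : Edges → ℕ → ℕ → ℕ → Set
HasEarAt E t r s = (s ≡ r + t ∸ 1) × E r s ≡ true

-- Colour validity pins down where nonempty blocks of ones may end: the last one of the
-- block of an active vertex p_v (d_v ≥ 1) is matched to the zero right after it, and
-- adjacent positions m, m+1 receive the same colour only across a block boundary of the
-- colouring, i.e. when k ∣ m.  Hence the zero closing such a block sits at a position
-- ≡ 1 (mod k).
--
-- Starting from the outer edge p_1 p_{n+2}, descend through apices of triangles while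
-- keeping a chord p_a p_c with c − a ≥ k + 1; when c − a = k + 1 it is an ear-edge.
-- Otherwise let p_b be the apex over p_a p_c.  If both p_a p_b and p_b p_c were shorter
-- than k + 1, then no vertex strictly between a and b (or b and c) is active, since the
-- first such vertex would close its block fewer than k positions after p_a (resp. p_b)
-- does.  So p_b is joined to every vertex up to p_c, and the blocks of p_a and p_b end
-- c − a − 1 positions apart, strictly between k and 2k: impossible for two positions
-- that are both ≡ 1 (mod k).

module Submission where

open import Defs
open import Data.Nat using (ℕ; zero; suc; pred; z<s; _+_; _*_; _∸_; _≤_; _<_; _≡ᵇ_; z≤n; s≤s; _≤?_)
open import Data.Nat.Properties
open import Data.Nat.DivMod
open import Data.Nat.Divisibility using (_∣_; divides; divides-refl; ∣m+n∣m⇒∣n; ∣⇒≤)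
open import Data.Nat.Induction using (<-rec)
open import Data.Bool using (Bool; true; false; if_then_else_; _∧_; _∨_; not; T)
open import Data.Bool.Properties using (∧-identityʳ; ∧-zeroʳ; ∨-inverseˡ; ¬-not)
open import Data.List using (List; []; _∷_; _++_; _∷ʳ_; replicate; concatMap; applyUpTo; length)
open import Data.List.Properties using (++-assoc; ++-identityʳ; length-++; length-replicate; concatMap-++; applyUpTo-∷ʳ; map-applyUpTo)
open import Data.List.Membership.Propositional using (_∈_)
open import Data.List.Relation.Unary.Any using (here; there)
open import Data.List.Relation.Unary.All using (lookup)
open import Data.Empty using (⊥; ⊥-elim)
open import Data.Product using (Σ; ∃; _×_; _,_; proj₁; proj₂)
open import Data.Sum using (inj₁; inj₂)
open import Function using (_∘_)
open import Relation.Nullary using (¬_; yes; no; contradiction)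
open import Relation.Binary.PropositionalEquality
open import Relation.Binary.Definitions using (tri<; tri≈; tri>)

countFrom-+ : ∀ f lo m m′ → countFrom f lo (m + m′) ≡ countFrom f lo m + countFrom f (lo + m) m′
countFrom-+ f lo zero m′ rewrite +-identityʳ lo = refl
countFrom-+ f lo (suc m) m′ rewrite countFrom-+ f (suc lo) m m′ | +-suc lo m =
  sym (+-assoc (if f lo then 1 else 0) _ _)

countFrom-cong : ∀ {f g} lo m → (∀ j → lo ≤ j → j < lo + m → f j ≡ g j) →
                 countFrom f lo m ≡ countFrom g lo m
countFrom-cong lo zero f≗g = refl
countFrom-cong lo (suc m) f≗g =
  cong₂ (λ b c → (if b then 1 else 0) + c)
        (f≗g lo ≤-refl (m<m+n lo z<s))
        (countFrom-cong (suc lo) m λ j lo<j j<lo+m →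
           f≗g j (<⇒≤ lo<j) (subst (j <_) (sym (+-suc lo m)) j<lo+m))

countFrom-false : ∀ lo m → countFrom (λ _ → false) lo m ≡ 0
countFrom-false lo zero = refl
countFrom-false lo (suc m) = countFrom-false (suc lo) m

countFrom-true : ∀ lo m → countFrom (λ _ → true) lo m ≡ m
countFrom-true lo zero = refl
countFrom-true lo (suc m) = cong suc (countFrom-true (suc lo) m)

countFrom-≤ : ∀ f lo m → countFrom f lo m ≤ m
countFrom-≤ f lo zero = z≤n
countFrom-≤ f lo (suc m) with f lo
... | true  = s≤s (countFrom-≤ f (suc lo) m)
... | false = m≤n⇒m≤1+n (countFrom-≤ f (suc lo) m)

countFrom-pos : ∀ f lo m j → lo ≤ j → j < lo + m → f j ≡ true → 1 ≤ countFrom f lo m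
countFrom-pos f lo zero j lo≤j j<lo+0 _ =
  contradiction lo≤j (<⇒≱ (subst (j <_) (+-identityʳ lo) j<lo+0))
countFrom-pos f lo (suc m) j lo≤j j<lo+m fj with f lo in flo
... | true  = s≤s z≤n
... | false = countFrom-pos f (suc lo) m j lo<j (subst (j <_) (+-suc lo m) j<lo+m) fj
  where
  lo<j : lo < j
  lo<j = ≤∧≢⇒< lo≤j λ { refl → contradiction (trans (sym flo) fj) λ () }

scan-adjacent : ∀ X Y j st → (j + length X , suc (j + length X)) ∈ scan j st (X ++ true ∷ false ∷ Y)
scan-adjacent [] Y j st rewrite +-identityʳ j = here refl
scan-adjacent (true ∷ X) Y j st rewrite +-suc j (length X) = scan-adjacent X Y (suc j) (j ∷ st)
scan-adjacent (false ∷ X) Y j [] rewrite +-suc j (length X) = scan-adjacent X Y (suc j) []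
scan-adjacent (false ∷ X) Y j (ℓ ∷ st) rewrite +-suc j (length X) = there (scan-adjacent X Y (suc j) st)

block : ℕ → List Bool
block d = replicate d true ++ false ∷ []

length-block : ∀ d → length (block d) ≡ suc d
length-block d = trans (length-++ (replicate d true)) (trans (cong (_+ 1) (length-replicate d)) (+-comm d 1))

block-suc-++ : ∀ e Z → block (suc e) ++ Z ≡ replicate e true ++ true ∷ false ∷ Z
block-suc-++ zero Z = refl
block-suc-++ (suc e) Z = cong (true ∷_) (block-suc-++ e Z)

blocks-split : ∀ (g : ℕ → ℕ) {n v e} → v < n → g v ≡ suc e →
  ∃ λ Y → concatMap block (applyUpTo g n) ≡
          (concatMap block (applyUpTo g v) ++ replicate e true) ++ true ∷ false ∷ Y
blocks-split g {suc n} {zero} {e} _ g0 =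
  concatMap block (applyUpTo (g ∘ suc) n) ,
  trans (cong (λ d → block d ++ concatMap block (applyUpTo (g ∘ suc) n)) g0) (block-suc-++ e _)
blocks-split g {suc n} {suc v} {e} (s≤s v<n) gv with blocks-split (g ∘ suc) v<n gv
... | Y , split = Y ,
  (begin
    block (g 0) ++ concatMap block (applyUpTo (g ∘ suc) n)
      ≡⟨ cong (block (g 0) ++_) split ⟩
    block (g 0) ++ (concatMap block (applyUpTo (g ∘ suc) v) ++ replicate e true) ++ Z
      ≡⟨ ++-assoc (block (g 0)) _ Z ⟨
    (block (g 0) ++ concatMap block (applyUpTo (g ∘ suc) v) ++ replicate e true) ++ Z
      ≡⟨ cong (_++ Z) (++-assoc (block (g 0)) _ (replicate e true)) ⟨
    ((block (g 0) ++ concatMap block (applyUpTo (g ∘ suc) v)) ++ replicate e true) ++ Z ∎)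
  where
  open ≡-Reasoning
  Z : List Bool
  Z = true ∷ false ∷ Y

-- Position in the 0/1 sequence built from d of the zero closing the v-th block.
blockEnd : (ℕ → ℕ) → ℕ → ℕ
blockEnd d zero = 0
blockEnd d (suc v) = suc (blockEnd d v + d (suc v))

length-blocks : ∀ d v → length (concatMap block (applyUpTo (d ∘ suc) v)) ≡ blockEnd d v
length-blocks d zero = refl
length-blocks d (suc v) = begin
  length (concatMap block (applyUpTo (d ∘ suc) (suc v)))
    ≡⟨ cong (length ∘ concatMap block) (applyUpTo-∷ʳ (d ∘ suc) v) ⟨
  length (concatMap block (applyUpTo (d ∘ suc) v ∷ʳ d (suc v)))
    ≡⟨ cong length (concatMap-++ block (applyUpTo (d ∘ suc) v) _) ⟩
  length (concatMap block (applyUpTo (d ∘ suc) v) ++ block (d (suc v)) ++ [])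
    ≡⟨ length-++ (concatMap block (applyUpTo (d ∘ suc) v)) ⟩
  length (concatMap block (applyUpTo (d ∘ suc) v)) + length (block (d (suc v)) ++ [])
    ≡⟨ cong₂ _+_ (length-blocks d v)
                 (trans (cong length (++-identityʳ (block (d (suc v))))) (length-block (d (suc v)))) ⟩
  blockEnd d v + suc (d (suc v))
    ≡⟨ +-suc (blockEnd d v) (d (suc v)) ⟩
  blockEnd d (suc v) ∎
  where open ≡-Reasoning

blockEnd-pos : ∀ d {v} → 1 ≤ v → 1 ≤ blockEnd d v
blockEnd-pos d {suc v} _ = s≤s z≤n

blockEnd-skip : ∀ d {x u} → x < u → (∀ w → x < w → w < u → d w ≡ 0) →
                blockEnd d u ≡ blockEnd d x + (u ∸ x + d u)
blockEnd-skip d {x} {suc u} (s≤s x≤u) empty with m≤n⇒m<n∨m≡n x≤u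
... | inj₂ refl = begin
  suc (blockEnd d x + d (suc x))       ≡⟨ +-suc (blockEnd d x) (d (suc x)) ⟨
  blockEnd d x + suc (d (suc x))       ≡⟨ cong (λ m → blockEnd d x + (m + d (suc x))) (m+n∸n≡m 1 x) ⟨
  blockEnd d x + (suc x ∸ x + d (suc x)) ∎
  where open ≡-Reasoning
... | inj₁ x<u = begin
  suc (blockEnd d u + d (suc u))
    ≡⟨ cong (λ b → suc (b + d (suc u))) (blockEnd-skip d x<u λ w x<w w<u → empty w x<w (m<n⇒m<1+n w<u)) ⟩
  suc (blockEnd d x + (u ∸ x + d u) + d (suc u))
    ≡⟨ cong (λ e → suc (blockEnd d x + (u ∸ x + e) + d (suc u))) (empty u x<u ≤-refl) ⟩
  suc (blockEnd d x + (u ∸ x + 0) + d (suc u))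
    ≡⟨ rearrange (blockEnd d x) (u ∸ x) (d (suc u)) ⟩
  blockEnd d x + (suc (u ∸ x) + d (suc u))
    ≡⟨ cong (λ m → blockEnd d x + (m + d (suc u))) (+-∸-assoc 1 x≤u) ⟨
  blockEnd d x + (suc u ∸ x + d (suc u)) ∎
  where
  open ≡-Reasoning
  rearrange : ∀ b m e → suc (b + (m + 0) + e) ≡ b + (suc m + e)
  rearrange b m e rewrite +-identityʳ m | +-assoc b m e = sym (+-suc b (m + e))

colour-decompose : ∀ k-1 q r → r < suc k-1 →
  colour (suc k-1) (suc (r + q * suc k-1)) ≡ (if isEven q then suc r else suc k-1 ∸ r)
colour-decompose k-1 q r r<k =
  cong₂ (λ q′ r′ → if isEven q′ then suc r′ else suc k-1 ∸ r′) quotient remainder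
  where
  quotient : (r + q * suc k-1) / suc k-1 ≡ q
  quotient = trans (+-distrib-/-∣ʳ r (divides-refl q))
                   (cong₂ _+_ (m<n⇒m/n≡0 r<k) (m*n/n≡m q (suc k-1)))
  remainder : (r + q * suc k-1) % suc k-1 ≡ r
  remainder = trans ([m+kn]%n≡m%n r q (suc k-1)) (m<n⇒m%n≡m r<k)

colour-adjacent : ∀ k-1 m → colour (suc k-1) (suc m) ≡ colour (suc k-1) (suc (suc m)) →
                  suc k-1 ∣ suc m
colour-adjacent k-1 m same =
  subst (λ m → k ∣ suc m) (sym m≡r+qk) (decomposed (m % k) (m / k) (m%n<n m k) (subst Same m≡r+qk same))
  where
  k : ℕ
  k = suc k-1
  Same : ℕ → Set
  Same m = colour k (suc m) ≡ colour k (suc (suc m))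
  m≡r+qk : m ≡ m % k + m / k * k
  m≡r+qk = m≡m%n+[m/n]*n m k
  decomposed : ∀ r q → r < k → Same (r + q * k) → k ∣ suc (r + q * k)
  decomposed r q r<k same with m≤n⇒m<n∨m≡n r<k
  ... | inj₂ refl = divides (suc q) refl
  ... | inj₁ r+1<k = contradiction
      (trans (sym (colour-decompose k-1 q r r<k)) (trans same (colour-decompose k-1 q (suc r) r+1<k)))
      (distinct (isEven q))
    where
    distinct : ∀ b → (if b then suc r else k ∸ r) ≢ (if b then suc (suc r) else k ∸ suc r)
    distinct true  eq = 1+n≢n (sym eq)
    distinct false eq = 1+n≢n (trans (sym (+-∸-assoc 1 (≤-pred r<k))) eq)

∤-between : ∀ {k q δ} → q * k < δ → δ < suc q * k → ¬ k ∣ δ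
∤-between {k} {q} below above (divides m refl) =
  <⇒≱ (*-cancelʳ-< k q m below) (≤-pred (*-cancelʳ-< k m (suc q) above))

∣-gap : ∀ {k P δ} → 1 ≤ P → k ∣ pred P → k ∣ pred (P + δ) → k ∣ δ
∣-gap {P = suc p} _ k∣p k∣p+δ = ∣m+n∣m⇒∣n k∣p+δ k∣p

counted : ℕ → Edges → ℕ → ℕ → Bool
counted n E i j = E i j ∧ (not (isHull n i j) ∨ ((i ≡ᵇ 1) ∧ (j ≡ᵇ n + 2)))

≡ᵇ-refl : ∀ m → (m ≡ᵇ m) ≡ true
≡ᵇ-refl zero = refl
≡ᵇ-refl (suc m) = ≡ᵇ-refl m

≢⇒≡ᵇ-false : ∀ {m n} → m ≢ n → (m ≡ᵇ n) ≡ false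
≢⇒≡ᵇ-false {m} {n} m≢n = ¬-not λ eq → m≢n (≡ᵇ⇒≡ m n (subst T (sym eq) _))

counted-hull : ∀ n-1 E i → counted (suc n-1) E i (suc i) ≡ false
counted-hull n-1 E i rewrite ≡ᵇ-refl i = trans (cong (E i (suc i) ∧_) (not-outer i)) (∧-zeroʳ _)
  where
  not-outer : ∀ i → ((i ≡ᵇ 1) ∧ (suc i ≡ᵇ suc n-1 + 2)) ≡ false
  not-outer zero = refl
  not-outer (suc zero) rewrite +-comm n-1 2 = refl
  not-outer (suc (suc i)) = refl

counted-chord : ∀ n E {i j} → 2 + i ≤ j → counted n E i j ≡ E i j
counted-chord n E {i} {j} 2+i≤j
  rewrite ≢⇒≡ᵇ-false (>⇒≢ 2+i≤j) | ∨-inverseˡ ((i ≡ᵇ 1) ∧ (j ≡ᵇ n + 2)) = ∧-identityʳ (E i j)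

2+i+[y∸1+i]≡1+y : ∀ {i y} → i < y → 2 + i + (y ∸ suc i) ≡ suc y
2+i+[y∸1+i]≡1+y i<y = cong suc (m+[n∸m]≡n i<y)

module _ (n-1 : ℕ) (E : Edges) where
  private
    n N : ℕ
    n = suc n-1
    N = n + 2

  outdeg-chords : ∀ {i} → i < N → outdeg n E i ≡ countFrom (E i) (2 + i) (N ∸ suc i)
  outdeg-chords {i} i<N = begin
    countFrom (counted n E i) (suc i) (N ∸ i)
      ≡⟨ cong (countFrom (counted n E i) (suc i)) (+-∸-assoc 1 i<N) ⟩
    countFrom (counted n E i) (suc i) (suc (N ∸ suc i))
      ≡⟨ cong (λ b → (if b then 1 else 0) + countFrom (counted n E i) (2 + i) (N ∸ suc i))
              (counted-hull n-1 E i) ⟩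
    countFrom (counted n E i) (2 + i) (N ∸ suc i)
      ≡⟨ countFrom-cong (2 + i) (N ∸ suc i) (λ j 2+i≤j _ → counted-chord n E 2+i≤j) ⟩
    countFrom (E i) (2 + i) (N ∸ suc i) ∎
    where open ≡-Reasoning

  outdeg-upTo : ∀ {i y} → i < y → y ≤ N → (∀ j → y < j → j ≤ N → E i j ≡ false) →
                outdeg n E i ≡ countFrom (E i) (2 + i) (y ∸ suc i)
  outdeg-upTo {i} {y} i<y y≤N beyond = begin
    outdeg n E i
      ≡⟨ outdeg-chords (<-≤-trans i<y y≤N) ⟩
    countFrom (E i) (2 + i) (N ∸ suc i)
      ≡⟨ cong (countFrom (E i) (2 + i)) split ⟩
    countFrom (E i) (2 + i) (y ∸ suc i + (N ∸ y))
      ≡⟨ countFrom-+ (E i) (2 + i) (y ∸ suc i) (N ∸ y) ⟩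
    countFrom (E i) (2 + i) (y ∸ suc i) + countFrom (E i) (2 + i + (y ∸ suc i)) (N ∸ y)
      ≡⟨ cong (countFrom (E i) (2 + i) (y ∸ suc i) +_) tail-empty ⟩
    countFrom (E i) (2 + i) (y ∸ suc i) + 0
      ≡⟨ +-identityʳ _ ⟩
    countFrom (E i) (2 + i) (y ∸ suc i) ∎
    where
    open ≡-Reasoning
    split : N ∸ suc i ≡ y ∸ suc i + (N ∸ y)
    split = trans (cong (_∸ suc i) (sym (m+[n∸m]≡n y≤N))) (+-∸-comm (N ∸ y) i<y)
    tail-empty : countFrom (E i) (2 + i + (y ∸ suc i)) (N ∸ y) ≡ 0
    tail-empty rewrite 2+i+[y∸1+i]≡1+y i<y =
      trans (countFrom-cong (suc y) (N ∸ y) λ j y<j j<1+N →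
                beyond j y<j (≤-pred (subst (j <_) (cong suc (m+[n∸m]≡n y≤N)) j<1+N)))
            (countFrom-false (suc y) (N ∸ y))

  outdeg-≤ : ∀ {i y} → i < y → y ≤ N → (∀ j → y < j → j ≤ N → E i j ≡ false) →
             suc i + outdeg n E i ≤ y
  outdeg-≤ {i} {y} i<y y≤N beyond = begin
    suc i + outdeg n E i    ≡⟨ cong (suc i +_) (outdeg-upTo i<y y≤N beyond) ⟩
    suc i + countFrom (E i) (2 + i) (y ∸ suc i)
      ≤⟨ +-monoʳ-≤ (suc i) (countFrom-≤ (E i) (2 + i) (y ∸ suc i)) ⟩
    suc i + (y ∸ suc i)     ≡⟨ m+[n∸m]≡n i<y ⟩
    y ∎
    where open ≤-Reasoning

  outdeg-fan : ∀ {i y} → i < y → y ≤ N → (∀ j → y < j → j ≤ N → E i j ≡ false) →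
               (∀ j → 2 + i ≤ j → j ≤ y → E i j ≡ true) → suc i + outdeg n E i ≡ y
  outdeg-fan {i} {y} i<y y≤N beyond fan = begin
    suc i + outdeg n E i    ≡⟨ cong (suc i +_) (outdeg-upTo i<y y≤N beyond) ⟩
    suc i + countFrom (E i) (2 + i) (y ∸ suc i)
      ≡⟨ cong (suc i +_) (countFrom-cong (2 + i) (y ∸ suc i) λ j 2+i≤j j< →
           fan j 2+i≤j (≤-pred (subst (j <_) (2+i+[y∸1+i]≡1+y i<y) j<))) ⟩
    suc i + countFrom (λ _ → true) (2 + i) (y ∸ suc i)
      ≡⟨ cong (suc i +_) (countFrom-true (2 + i) (y ∸ suc i)) ⟩
    suc i + (y ∸ suc i)     ≡⟨ m+[n∸m]≡n i<y ⟩
    y ∎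
    where open ≡-Reasoning

  chord⇒outdeg-pos : ∀ {i j} → 2 + i ≤ j → j ≤ N → E i j ≡ true → 1 ≤ outdeg n E i
  chord⇒outdeg-pos {i} {j} 2+i≤j j≤N eij =
    subst (1 ≤_) (sym (outdeg-chords i<N))
      (countFrom-pos (E i) (2 + i) (N ∸ suc i) j 2+i≤j
        (subst (j <_) (sym (2+i+[y∸1+i]≡1+y i<N)) (s≤s j≤N)) eij)
    where
    i<N : i < N
    i<N = <-≤-trans (≤-trans (n≤1+n (suc i)) 2+i≤j) j≤N

lastTrue : (P : ℕ → Bool) {lo : ℕ} (hi : ℕ) → lo ≤ hi → P lo ≡ true →
  ∃ λ j → lo ≤ j × j ≤ hi × P j ≡ true × (∀ j′ → j < j′ → j′ ≤ hi → P j′ ≡ false)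
lastTrue P zero z≤n p0 = zero , z≤n , z≤n , p0 , λ j′ 0<j′ j′≤0 → contradiction j′≤0 (<⇒≱ 0<j′)
lastTrue P {lo} (suc hi) lo≤hi+1 plo with P (suc hi) in phi
... | true = suc hi , lo≤hi+1 , ≤-refl , phi , λ j′ hi<j′ j′≤hi → contradiction j′≤hi (<⇒≱ hi<j′)
... | false with m≤n⇒m<n∨m≡n lo≤hi+1
...   | inj₂ refl = contradiction (trans (sym plo) phi) λ ()
...   | inj₁ lo≤hi with lastTrue P hi (≤-pred lo≤hi) plo
...     | j , lo≤j , j≤hi , pj , after = j , lo≤j , m≤n⇒m≤1+n j≤hi , pj , after′
  where
  after′ : ∀ j′ → j < j′ → j′ ≤ suc hi → P j′ ≡ false
  after′ j′ j<j′ j′≤hi+1 with m≤n⇒m<n∨m≡n j′≤hi+1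
  ... | inj₁ j′≤hi = after j′ j<j′ (≤-pred j′≤hi)
  ... | inj₂ refl = phi

module _ {n : ℕ} {E : Edges} (T : Triangulation n E) where
  open Triangulation T

  crossing⇒non-edge : ∀ {i j a b} → E i j ≡ true → Cross i j a b → E a b ≡ false
  crossing⇒non-edge {i} {j} {a} {b} eij cross = ¬-not λ eab → plane i j a b eij eab cross

  uncrossed⇒edge : ∀ {i j} → 1 ≤ i → i < j → j ≤ n + 2 →
                   (∀ a b → E a b ≡ true → ¬ Cross i j a b) → E i j ≡ true
  uncrossed⇒edge {i} {j} 1≤i i<j j≤N uncrossed with E i j in eij
  ... | true = refl
  ... | false with maximal i j 1≤i i<j j≤N eij
  ...   | a , b , eab , cross = contradiction cross (uncrossed a b eab)

  hull-edge : ∀ {i} → 1 ≤ i → suc i ≤ n + 2 → E i (suc i) ≡ true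
  hull-edge 1≤i i<N = uncrossed⇒edge 1≤i ≤-refl i<N λ where
    a b _ (inj₁ (i<a , a<i+1 , _)) → <⇒≱ a<i+1 i<a
    a b _ (inj₂ (_ , i<b , b<i+1)) → <⇒≱ b<i+1 i<b

  outer-edge : E 1 (n + 2) ≡ true
  outer-edge = uncrossed⇒edge ≤-refl (m≤n+m 2 n) ≤-refl λ where
    a b eab (inj₁ (_ , _ , N<b)) → <⇒≱ N<b (proj₂ (proj₂ (inRange a b eab)))
    a b eab (inj₂ (a<1 , _ , _)) → <⇒≱ a<1 (proj₁ (inRange a b eab))

  apex : ∀ {a c} → 1 ≤ a → 2 + a ≤ c → c ≤ n + 2 → E a c ≡ true →
         ∃ λ b → a < b × b < c × E a b ≡ true × E b c ≡ true
  apex {a} {suc c} 1≤a (s≤s a<c) c≤N eac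
    with lastTrue (E a) c a<c (hull-edge 1≤a (≤-trans a<c (<⇒≤ c≤N)))
  ... | b , a<b , b≤c , eab , last =
    b , a<b , s≤s b≤c , eab , uncrossed⇒edge (≤-trans 1≤a (<⇒≤ a<b)) (s≤s b≤c) c≤N uncrossed
    where
    uncrossed : ∀ x y → E x y ≡ true → ¬ Cross b (suc c) x y
    uncrossed x y exy (inj₁ (b<x , x<c , c<y)) = plane a (suc c) x y eac exy (inj₁ (<-trans a<b b<x , x<c , c<y))
    uncrossed x y exy (inj₂ (x<b , b<y , y<c)) with <-cmp x a
    ... | tri< x<a _ _ = plane a (suc c) x y eac exy (inj₂ (x<a , <-trans a<b b<y , y<c))
    ... | tri> _ _ a<x = plane a b x y eab exy (inj₁ (a<x , x<b , b<y))
    ... | tri≈ _ refl _ = contradiction (trans (sym exy) (last y b<y (≤-pred y<c))) λ ()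

module EarSearch (k-1 n-1 : ℕ) (E : Edges) (T : Triangulation (suc n-1) E)
                 (valid : ColorValid (suc k-1) (suc n-1) E) where
  open Triangulation T

  k n N : ℕ
  k = suc k-1
  n = suc n-1
  N = n + 2

  d : ℕ → ℕ
  d = outdeg n E

  active⇒aligned : ∀ {v} → 1 ≤ v → v ≤ n → 1 ≤ d v → k ∣ pred (blockEnd d v)
  active⇒aligned {suc w} _ w<n active with d (suc w) in dv | active
  ... | suc e | _ with blocks-split (d ∘ suc) w<n dv
  ...   | Y , split =
    subst (k ∣_) (trans (cong suc L≡) (sym (+-suc (blockEnd d w) e)))
          (colour-adjacent k-1 L (lookup valid matched))
    where
    X : List Bool
    X = concatMap block (applyUpTo (d ∘ suc) w) ++ replicate e true
    L : ℕ
    L = length X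
    b≡X++Y : bSeq n E ≡ X ++ true ∷ false ∷ Y
    b≡X++Y = trans (cong (concatMap block) (map-applyUpTo suc d n)) split
    matched : (suc L , suc (suc L)) ∈ matching n E
    matched = subst (λ b → (suc L , suc (suc L)) ∈ scan 1 [] b) (sym b≡X++Y) (scan-adjacent X Y 1 [])
    L≡ : L ≡ blockEnd d w + e
    L≡ = trans (length-++ (concatMap block (applyUpTo (d ∘ suc) w)))
               (cong₂ _+_ (length-blocks d w) (length-replicate e))

  chord-source≤n : ∀ {v j} → 2 + v ≤ j → j ≤ N → v ≤ n
  chord-source≤n 2+v≤j j≤N = ≤-pred (≤-pred (≤-trans 2+v≤j (≤-trans j≤N (≤-reflexive (+-comm n 2)))))

  idle⇒no-chord : ∀ {x y} → d x ≡ 0 → 2 + x ≤ y → ¬ E x y ≡ true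
  idle⇒no-chord {x} {y} idle 2+x≤y exy =
    contradiction (subst (1 ≤_) idle (chord⇒outdeg-pos n-1 E 2+x≤y (proj₂ (proj₂ (inRange x y exy))) exy))
                  λ ()

  inactive-under : ∀ {x y} → 1 ≤ x → y ≤ N → y ≤ x + k → E x y ≡ true →
                   k ∣ pred (blockEnd d x) → ∀ u → x < u → u < y → d u ≡ 0
  inactive-under {x} {y} 1≤x y≤N y≤x+k exy x-aligned = <-rec _ inactive
    where
    inactive : ∀ u → (∀ {w} → w < u → x < w → w < y → d w ≡ 0) → x < u → u < y → d u ≡ 0
    inactive u earlier x<u u<y with d u in du
    ... | zero = refl
    ... | suc e =
      contradiction (∣-gap (blockEnd-pos d 1≤x) x-aligned (subst (λ b → k ∣ pred b) skip u-aligned))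
                    (∤-between {q = 0} 0<δ δ<k)
      where
      beyond : ∀ j → y < j → j ≤ N → E u j ≡ false
      beyond j y<j _ = crossing⇒non-edge T exy (inj₁ (x<u , u<y , y<j))
      bound : suc u + d u ≤ y
      bound = outdeg-≤ n-1 E u<y y≤N beyond
      active : 1 ≤ d u
      active = subst (1 ≤_) (sym du) (s≤s z≤n)
      2+u≤y : 2 + u ≤ y
      2+u≤y = ≤-trans (subst (λ m → 2 + u ≤ suc u + m) (sym du) (s≤s (m<m+n u z<s))) bound
      u-aligned : k ∣ pred (blockEnd d u)
      u-aligned = active⇒aligned (≤-trans 1≤x (<⇒≤ x<u)) (chord-source≤n 2+u≤y y≤N) active
      δ : ℕ
      δ = u ∸ x + d u
      skip : blockEnd d u ≡ blockEnd d x + δ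
      skip = blockEnd-skip d x<u λ w x<w w<u → earlier w<u x<w (<-trans w<u u<y)
      0<δ : 0 * k < δ
      0<δ = ≤-trans (m<n⇒0<n∸m x<u) (m≤m+n (u ∸ x) (d u))
      δ<k : δ < 1 * k
      δ<k = subst (δ <_) (sym (*-identityˡ k)) (+-cancelˡ-< x δ k (begin-strict
        x + δ         ≡⟨ +-assoc x (u ∸ x) (d u) ⟨
        x + (u ∸ x) + d u ≡⟨ cong (_+ d u) (m+[n∸m]≡n (<⇒≤ x<u)) ⟩
        u + d u       <⟨ bound ⟩
        y             ≤⟨ y≤x+k ⟩
        x + k         ∎))
        where open ≤-Reasoning

  no-short-triangle : ∀ {a b c} → 1 ≤ a → a < b → b < c → c ≤ N →
                      E a b ≡ true → E b c ≡ true → E a c ≡ true →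
                      b ≤ a + k → c ≤ b + k → 2 + (a + k) ≤ c → ⊥
  no-short-triangle {a} {b} {c} 1≤a a<b b<c c≤N eab ebc eac b≤a+k c≤b+k far =
    ∤-between {q = 1} k<δ δ<2k
      (∣-gap (blockEnd-pos d 1≤a) a-aligned (subst (λ e → k ∣ pred e) skip b-aligned))
    where
    1≤b : 1 ≤ b
    1≤b = ≤-trans 1≤a (<⇒≤ a<b)
    2+b≤c : 2 + b ≤ c
    2+b≤c = ≤-trans (s≤s (s≤s b≤a+k)) far
    2+a≤c : 2 + a ≤ c
    2+a≤c = ≤-trans (s≤s (s≤s (<⇒≤ a<b))) 2+b≤c
    a-aligned : k ∣ pred (blockEnd d a)
    a-aligned = active⇒aligned 1≤a (chord-source≤n 2+a≤c c≤N) (chord⇒outdeg-pos n-1 E 2+a≤c c≤N eac)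
    b-aligned : k ∣ pred (blockEnd d b)
    b-aligned = active⇒aligned 1≤b (chord-source≤n 2+b≤c c≤N) (chord⇒outdeg-pos n-1 E 2+b≤c c≤N ebc)
    fan : ∀ j → 2 + b ≤ j → j ≤ c → E b j ≡ true
    fan j 2+b≤j j≤c = uncrossed⇒edge T 1≤b (≤-trans (n≤1+n (suc b)) 2+b≤j) (≤-trans j≤c c≤N) uncrossed
      where
      uncrossed : ∀ x y → E x y ≡ true → ¬ Cross b j x y
      uncrossed x y exy (inj₁ (b<x , x<j , j<y)) =
        idle⇒no-chord (inactive-under 1≤b c≤N c≤b+k ebc b-aligned x b<x (<-≤-trans x<j j≤c))
                      (≤-trans (s≤s x<j) j<y) exy
      uncrossed x y exy (inj₂ (x<b , b<y , y<j)) = plane b c x y ebc exy (inj₂ (x<b , b<y , <-≤-trans y<j j≤c))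
    beyond : ∀ j → c < j → j ≤ N → E b j ≡ false
    beyond j c<j _ = crossing⇒non-edge T eac (inj₁ (a<b , b<c , c<j))
    δ : ℕ
    δ = b ∸ a + d b
    skip : blockEnd d b ≡ blockEnd d a + δ
    skip = blockEnd-skip d a<b (inactive-under 1≤a (≤-trans (<⇒≤ b<c) c≤N) b≤a+k eab a-aligned)
    a+1+δ≡c : a + suc δ ≡ c
    a+1+δ≡c = begin
      a + suc δ           ≡⟨ +-suc a δ ⟩
      suc (a + δ)         ≡⟨ cong suc (+-assoc a (b ∸ a) (d b)) ⟨
      suc (a + (b ∸ a) + d b) ≡⟨ cong (λ m → suc (m + d b)) (m+[n∸m]≡n (<⇒≤ a<b)) ⟩
      suc b + d b         ≡⟨ outdeg-fan n-1 E b<c c≤N beyond fan ⟩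
      c                   ∎
      where open ≡-Reasoning
    k<δ : 1 * k < δ
    k<δ = subst (_< δ) (sym (*-identityˡ k)) (≤-pred (+-cancelˡ-≤ a (2 + k) (suc δ)
            (subst₂ _≤_ (sym (trans (+-suc a (suc k)) (cong suc (+-suc a k)))) (sym a+1+δ≡c) far)))
    δ<2k : δ < 2 * k
    δ<2k = subst (δ <_) (cong (k +_) (sym (+-identityʳ k))) (+-cancelˡ-≤ a (suc δ) (k + k) (begin
      a + suc δ   ≡⟨ a+1+δ≡c ⟩
      c           ≤⟨ c≤b+k ⟩
      b + k       ≤⟨ +-monoˡ-≤ k b≤a+k ⟩
      a + k + k   ≡⟨ +-assoc a k k ⟩
      a + (k + k) ∎))
      where open ≤-Reasoning

  Ear : Set
  Ear = Σ ℕ λ r → 1 ≤ r × r + (k + 2) ∸ 1 ≤ N × HasEarAt E (k + 2) r (r + (k + 2) ∸ 1)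

  ear-at : ∀ {a} → 1 ≤ a → a + suc k ≤ N → E a (a + suc k) ≡ true → Ear
  ear-at {a} 1≤a fits edge =
    a , 1≤a , subst (_≤ N) (sym last≡) fits , refl , subst (λ s → E a s ≡ true) (sym last≡) edge
    where
    last≡ : a + (k + 2) ∸ 1 ≡ a + suc k
    last≡ = trans (cong (λ m → a + m ∸ 1) (+-comm k 2)) (cong (_∸ 1) (+-suc a (suc k)))

  ear-under : ∀ {a c} → 1 ≤ a → c ≤ N → a + suc k ≤ c → E a c ≡ true → Ear
  ear-under {a} {c} = <-rec Goal descend (c ∸ a) refl
    where
    Goal : ℕ → Set
    Goal w = ∀ {a c} → c ∸ a ≡ w → 1 ≤ a → c ≤ N → a + suc k ≤ c → E a c ≡ true → Ear
    descend : ∀ w → (∀ {v} → v < w → Goal v) → Goal w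
    descend _ rec {a} {c} refl 1≤a c≤N long eac with m≤n⇒m<n∨m≡n long
    ... | inj₂ refl = ear-at 1≤a c≤N eac
    ... | inj₁ longer with apex T 1≤a (≤-trans (s≤s (m<m+n a z<s)) longer) c≤N eac
    ...   | b , a<b , b<c , eab , ebc with a + suc k ≤? b | b + suc k ≤? c
    ...     | yes left | _ = rec (∸-monoˡ-< b<c (<⇒≤ a<b)) refl 1≤a (≤-trans (<⇒≤ b<c) c≤N) left eab
    ...     | no _ | yes right = rec (∸-monoʳ-< a<b (<⇒≤ b<c)) refl (≤-trans 1≤a (<⇒≤ a<b)) c≤N right ebc
    ...     | no left | no right =
      ⊥-elim (no-short-triangle 1≤a a<b b<c c≤N eab ebc eac (shorter left) (shorter right)
                (subst (_≤ c) (cong suc (+-suc a k)) longer))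
      where
      shorter : ∀ {x y} → ¬ x + suc k ≤ y → y ≤ x + k
      shorter {x} {y} ¬long = ≤-pred (subst (y <_) (+-suc x k) (≰⇒> ¬long))

lemma5 : (k n : ℕ) → 2 ≤ k → 1 ≤ n → k ∣ n → (E : Edges) →
         Triangulation n E → ColorValid k n E →
         Σ ℕ λ r → 1 ≤ r × r + (k + 2) ∸ 1 ≤ n + 2 × HasEarAt E (k + 2) r (r + (k + 2) ∸ 1)
lemma5 (suc k-1) (suc n-1) _ _ k∣n E T valid =
  ear-under ≤-refl ≤-refl outer-long (outer-edge T)
  where
  open EarSearch k-1 n-1 E T valid
  outer-long : 1 + suc k ≤ n + 2
  outer-long = ≤-trans (s≤s (s≤s (∣⇒≤ k∣n))) (≤-reflexive (+-comm 2 n))
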